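{- Let $k \ge 1$ and $m, n \ge 2$ be integers, and let $r_1 = m \bmod (k+1)$ and $r_2 = n \bmod (k+1)$ (remainders in $\{0,\dots,k\}$). Then $$d_k(P_m \Box P_n) \le \frac{mn - r_1 r_2}{k+1} + \min\{r_1, r_2\}.$$
   Context: $P_n$ is the path on $n$ vertices; $P_m \Box P_n$ is the Cartesian product ($m\times n$ grid): vertices $(i,j)$, $0\le i\le m-1$, $0\le j\le n-1$, with $(i,j)$ adjacent to $(i',j')$ iff ($|i-i'|=1$ and $j=j'$) or ($i=i'$ and $|j-j'|=1$). The $k$-move deduction game ($k$ a positive integer) on a finite graph $G$: a layout places a finite number of searchers on vertices of $G$ (several searchers may share a vertex). Every searcher is initially mobile. A vertex is protected once it has been occupied by some searcher (so initially occupied vertices are protected); other vertices are unprotected. The game proceeds in stages. At each stage, for every vertex $v$ that has at least one unprotected neighbour: if the number of mobile searchers on $v$ is at least the number of unprotected neighbours of $v$, then the mobile searchers on $v$ move to the unprotected neighbours of $v$ so that each unprotected neighbour receives at least one searcher; excess mobile searchers on $v$ may also move to any of these unprotected neighbours. All moves in a stage happen simultaneously, newly occupied vertices become protected, and a searcher that has moved $k$ times becomes immobile. The process repeats until all vertices are protected or no searcher can move. A layout is successful if all vertices of $G$ end up protected. The $k$-move deduction number $d_k(G)$ is the minimum number of searchers in a successful layout on $G$. -}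

module Defs where

open import Data.Nat using (ℕ; zero; suc; _+_; _≤_; _<_; _≤?_)
import Data.Nat as ℕ
open import Data.Fin using (Fin; toℕ)
import Data.Fin as F
open import Data.Bool using (Bool; true; false; _∧_; _∨_; not; if_then_else_; T)
open import Data.Product using (Σ; ∃; _×_; _,_)
open import Data.Product.Properties using (≡-dec)
open import Data.Sum using (_⊎_)
open import Relation.Nullary.Decidable using (⌊_⌋)
open import Relation.Binary.PropositionalEquality using (_≡_)
open import Relation.Binary.Construct.Closure.ReflexiveTransitive using (Star)

Vtx : ℕ → ℕ → Set
Vtx m n = Fin m × Fin n

_≟V_ : ∀ {m n} (u v : Vtx m n) → _
_≟V_ = ≡-dec F._≟_ F._≟_

dist1 : ℕ → ℕ → Bool
dist1 a b = ⌊ a ℕ.≟ suc b ⌋ ∨ ⌊ suc a ℕ.≟ b ⌋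

adj : ∀ {m n} → Vtx m n → Vtx m n → Bool
adj (i , j) (i' , j') =
  (dist1 (toℕ i) (toℕ i') ∧ ⌊ j F.≟ j' ⌋) ∨ (⌊ i F.≟ i' ⌋ ∧ dist1 (toℕ j) (toℕ j'))

sumF : ∀ {N} → (Fin N → ℕ) → ℕ
sumF {zero} f = 0
sumF {suc N} f = f F.zero + sumF (λ x → f (F.suc x))

countF : ∀ {N} → (Fin N → Bool) → ℕ
countF f = sumF (λ x → if f x then 1 else 0)

anyF : ∀ {N} → (Fin N → Bool) → Bool
anyF {zero} f = false
anyF {suc N} f = f F.zero ∨ anyF (λ x → f (F.suc x))

countV : ∀ {m n} → (Vtx m n → Bool) → ℕ
countV f = sumF (λ i → countF (λ j → f (i , j)))

record State (m n s : ℕ) : Set where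
  field
    pos   : Fin s → Vtx m n
    moves : Fin s → ℕ
    prot  : Vtx m n → Bool
open State public

occupied : ∀ {m n s} → (Fin s → Vtx m n) → Vtx m n → Bool
occupied p u = anyF (λ σ → ⌊ p σ ≟V u ⌋)

module _ (k : ℕ) {m n s : ℕ} where

  unprotNbr : State m n s → Vtx m n → Vtx m n → Bool
  unprotNbr st v u = adj v u ∧ not (prot st u)

  #unprot : State m n s → Vtx m n → ℕ
  #unprot st v = countV (unprotNbr st v)

  mobileB : State m n s → Fin s → Bool
  mobileB st σ = ⌊ suc (moves st σ) ≤? k ⌋

  #mobile : State m n s → Vtx m n → ℕ
  #mobile st v = countF (λ σ → ⌊ pos st σ ≟V v ⌋ ∧ mobileB st σ)

  Active : State m n s → Vtx m n → Set
  Active st v = (1 ≤ #unprot st v) × (#unprot st v ≤ #mobile st v)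

  -- one stage of the k-move deduction game (all moves simultaneous)
  record Step (st st' : State m n s) : Set where
    field
      searcherMove : ∀ σ →
        (pos st' σ ≡ pos st σ × moves st' σ ≡ moves st σ)
        ⊎ (T (mobileB st σ) × Active st (pos st σ)
           × T (unprotNbr st (pos st σ) (pos st' σ))
           × moves st' σ ≡ suc (moves st σ))
      cover : ∀ v → Active st v → ∀ u → T (unprotNbr st v u) →
        ∃ λ σ → pos st σ ≡ v × pos st' σ ≡ u
      protUpdate : ∀ u → prot st' u ≡ (prot st u ∨ occupied (pos st') u)

  initial : (Fin s → Vtx m n) → State m n s
  initial p = record { pos = p ; moves = λ _ → 0 ; prot = occupied p }

  Successful : (Fin s → Vtx m n) → Set
  Successful p = ∃ λ st → Star Step (initial p) st × (∀ u → T (prot st u))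

dk≤ : (k m n B : ℕ) → Set
dk≤ k m n B = ∃ λ s → s ≤ B × Σ (Fin s → Vtx m n) (Successful k)

-- Write K = k + 1, m = r₁ + q₁ K, n = r₂ + q₂ K and assume r₁ ≤ r₂ (otherwise transpose the
-- grid). Cut each of the top r₁ rows into an initial segment of r₂ cells followed by q₂
-- segments of K cells, and put a searcher on the first cell of every segment: the initial one
-- sweeps right at once, each other one is held back by its two unprotected neighbours until the
-- last cell of the segment to its left is protected, and then sweeps its k further cells. The
-- remaining q₁ K rows form q₁ bands of K rows; a searcher on every cell of the top row of each
-- band sweeps down its column, moving as soon as its left, right and upper neighbours are
-- protected. That is q₁ n + r₁ (q₂ + 1) = (m n − r₁ r₂) / K + r₁ searchers.
--
-- No two searchers ever share a vertex, so a vertex fires exactly when it carries a mobile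
-- searcher and has a single unprotected neighbour. The play is therefore determined by the
-- stage τ u at which each cell u gets protected, and it suffices to check this local rule for
-- every searcher at every stage.

{-# OPTIONS --safe #-}
module Submission where

open import Defs
open import Data.Nat
  using (ℕ; zero; suc; _+_; _*_; _∸_; _≤_; _<_; _≤′_; ≤′-refl; ≤′-step; _≤?_; _<?_; _≟_; z≤n; s≤s; _⊓_; _⊔_; NonZero)
open import Data.Nat.Properties
open import Data.Nat.DivMod
open import Data.Nat.Divisibility using (n∣m*n)
open import Data.Nat.Tactic.RingSolver using (solve-∀)
open import Data.Fin using (Fin; toℕ; fromℕ<)
import Data.Fin as F
open import Data.Fin.Properties using (toℕ-injective; toℕ<n; toℕ-fromℕ<; +↔⊎; *↔×)
import Data.Fin.Properties as FP
open import Data.Bool using (Bool; true; false; _∧_; _∨_; not; if_then_else_; T)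
open import Data.Bool.Properties using (T-∨; T-∧)
open import Data.Product using (∃; _×_; _,_; proj₁; proj₂; swap)
open import Data.Sum using (_⊎_; inj₁; inj₂)
open import Data.Empty using (⊥-elim)
open import Data.Unit using (tt)
open import Function using (_∘_)
open import Function.Bundles using (Equivalence; Injection; Inverse; _↔_)
open import Function.Properties.Inverse using (↔⇒↣)
open import Function.Construct.Composition using (_↔-∘_)
open import Data.Sum.Function.Propositional using (_⊎-↔_)
open import Relation.Nullary using (¬_; Dec; yes; no)
open import Relation.Binary using (tri<; tri≈; tri>; DecidableEquality)
open import Data.Product.Properties using (≡-dec)
open import Relation.Nullary.Decidable using (⌊_⌋; toWitness; fromWitness)
open import Relation.Binary.PropositionalEquality
open import Relation.Binary.Construct.Closure.ReflexiveTransitive using (Star; ε; _◅_; _◅◅_)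

sumF-≥ : ∀ {N} (f : Fin N → ℕ) x → f x ≤ sumF f
sumF-≥ f F.zero    = m≤m+n _ _
sumF-≥ f (F.suc x) = ≤-trans (sumF-≥ (f ∘ F.suc) x) (m≤n+m _ _)

sumF-≥₂ : ∀ {N} (f : Fin N → ℕ) {x y} → x ≢ y → f x + f y ≤ sumF f
sumF-≥₂ f {F.zero}  {F.zero}  x≢y = ⊥-elim (x≢y refl)
sumF-≥₂ f {F.zero}  {F.suc y} _   = +-monoʳ-≤ (f F.zero) (sumF-≥ (f ∘ F.suc) y)
sumF-≥₂ f {F.suc x} {F.zero}  _   =
  subst (_≤ sumF f) (+-comm (f F.zero) _) (+-monoʳ-≤ (f F.zero) (sumF-≥ (f ∘ F.suc) x))
sumF-≥₂ f {F.suc x} {F.suc y} x≢y =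
  ≤-trans (sumF-≥₂ (f ∘ F.suc) (x≢y ∘ cong F.suc)) (m≤n+m _ _)

sumF-≥1⇒∃ : ∀ {N} (f : Fin N → ℕ) → 1 ≤ sumF f → ∃ λ x → 1 ≤ f x
sumF-≥1⇒∃ {suc N} f 1≤sum with f F.zero in head≡
... | suc _ = F.zero , subst (1 ≤_) (sym head≡) (s≤s z≤n)
... | zero  = let (x , 1≤fx) = sumF-≥1⇒∃ (f ∘ F.suc) 1≤sum in F.suc x , 1≤fx

sumF-≡0 : ∀ {N} (f : Fin N → ℕ) → (∀ x → f x ≡ 0) → sumF f ≡ 0
sumF-≡0 {zero}  f _     = refl
sumF-≡0 {suc N} f zeros = cong₂ _+_ (zeros F.zero) (sumF-≡0 (f ∘ F.suc) (zeros ∘ F.suc))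

sumF-≤1 : ∀ {N} (f : Fin N → ℕ) → (∀ x → f x ≤ 1) →
          (∀ x y → 1 ≤ f x → 1 ≤ f y → x ≡ y) → sumF f ≤ 1
sumF-≤1 {zero}  f _  _      = z≤n
sumF-≤1 {suc N} f ≤1 unique with 1 ≤? f F.zero
... | yes 1≤head = subst (λ r → f F.zero + r ≤ 1) (sym (sumF-≡0 (f ∘ F.suc) tail≡0))
                     (subst (_≤ 1) (sym (+-identityʳ _)) (≤1 F.zero))
  where
  tail≡0 : ∀ x → f (F.suc x) ≡ 0
  tail≡0 x = n<1⇒n≡0 (≰⇒> λ 1≤fx → FP.0≢1+n (unique F.zero (F.suc x) 1≤head 1≤fx))
... | no 1≰head = subst (λ h → h + sumF (f ∘ F.suc) ≤ 1) (sym (n<1⇒n≡0 (≰⇒> 1≰head)))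
                    (sumF-≤1 (f ∘ F.suc) (≤1 ∘ F.suc)
                      (λ x y 1≤fx 1≤fy → FP.suc-injective (unique (F.suc x) (F.suc y) 1≤fx 1≤fy)))

T⇒1≤if : ∀ {b} → T b → 1 ≤ (if b then 1 else 0)
T⇒1≤if {true} _ = ≤-refl

1≤if⇒T : ∀ {b} → 1 ≤ (if b then 1 else 0) → T b
1≤if⇒T {true} _ = tt

if≤1 : ∀ b → (if b then 1 else 0) ≤ 1
if≤1 true  = ≤-refl
if≤1 false = z≤n

countF-≥1 : ∀ {N} (f : Fin N → Bool) x → T (f x) → 1 ≤ countF f
countF-≥1 f x fx = ≤-trans (T⇒1≤if fx) (sumF-≥ _ x)

countF-≥2 : ∀ {N} (f : Fin N → Bool) {x y} → x ≢ y → T (f x) → T (f y) → 2 ≤ countF f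
countF-≥2 f x≢y fx fy = ≤-trans (+-mono-≤ (T⇒1≤if fx) (T⇒1≤if fy)) (sumF-≥₂ _ x≢y)

countF-≥1⇒∃ : ∀ {N} (f : Fin N → Bool) → 1 ≤ countF f → ∃ λ x → T (f x)
countF-≥1⇒∃ f 1≤count = let (x , 1≤fx) = sumF-≥1⇒∃ _ 1≤count in x , 1≤if⇒T 1≤fx

countF-≤1 : ∀ {N} (f : Fin N → Bool) → (∀ x y → T (f x) → T (f y) → x ≡ y) → countF f ≤ 1
countF-≤1 f unique =
  sumF-≤1 _ (if≤1 ∘ f) (λ x y 1≤fx 1≤fy → unique x y (1≤if⇒T 1≤fx) (1≤if⇒T 1≤fy))

countV-≥1 : ∀ {m n} (f : Vtx m n → Bool) u → T (f u) → 1 ≤ countV f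
countV-≥1 f (i , j) fu = ≤-trans (countF-≥1 _ j fu) (sumF-≥ _ i)

countV-≥2 : ∀ {m n} (f : Vtx m n → Bool) {u w} → u ≢ w → T (f u) → T (f w) → 2 ≤ countV f
countV-≥2 f {i , j} {i′ , j′} u≢w fu fw with i F.≟ i′
... | yes refl = ≤-trans (countF-≥2 _ (u≢w ∘ cong (i ,_)) fu fw) (sumF-≥ _ i)
... | no i≢i′  = ≤-trans (+-mono-≤ (countF-≥1 _ j fu) (countF-≥1 _ j′ fw)) (sumF-≥₂ _ i≢i′)

countV-≤1 : ∀ {m n} (f : Vtx m n → Bool) → (∀ u w → T (f u) → T (f w) → u ≡ w) → countV f ≤ 1
countV-≤1 f unique = sumF-≤1 _
  (λ i → countF-≤1 _ λ j j′ fij fij′ → cong proj₂ (unique _ _ fij fij′))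
  (λ i i′ 1≤row 1≤row′ →
     let (j , fij) = countF-≥1⇒∃ _ 1≤row ; (j′ , fij′) = countF-≥1⇒∃ _ 1≤row′
     in cong proj₁ (unique (i , j) (i′ , j′) fij fij′))

-- Cells of the grid with natural-number coordinates

Cell : Set
Cell = ℕ × ℕ

_≟C_ : DecidableEquality Cell
_≟C_ = ≡-dec _≟_ _≟_

InGrid : ℕ → ℕ → Cell → Set
InGrid m n (i , j) = i < m × j < n

data Adjacent : Cell → Cell → Set where
  up    : ∀ {i j i′ j′} → i ≡ suc i′ → j ≡ j′ → Adjacent (i , j) (i′ , j′)
  down  : ∀ {i j i′ j′} → suc i ≡ i′ → j ≡ j′ → Adjacent (i , j) (i′ , j′)
  left  : ∀ {i j i′ j′} → i ≡ i′ → j ≡ suc j′ → Adjacent (i , j) (i′ , j′)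
  right : ∀ {i j i′ j′} → i ≡ i′ → suc j ≡ j′ → Adjacent (i , j) (i′ , j′)

toCell : ∀ {m n} → Vtx m n → Cell
toCell (i , j) = toℕ i , toℕ j

fromCell : ∀ {m n} (u : Cell) → InGrid m n u → Vtx m n
fromCell (i , j) (i<m , j<n) = fromℕ< i<m , fromℕ< j<n

toCell-fromCell : ∀ {m n} u (u∈ : InGrid m n u) → toCell (fromCell u u∈) ≡ u
toCell-fromCell (i , j) (i<m , j<n) = cong₂ _,_ (toℕ-fromℕ< i<m) (toℕ-fromℕ< j<n)

toCell-injective : ∀ {m n} {u w : Vtx m n} → toCell u ≡ toCell w → u ≡ w
toCell-injective {u = _ , _} {_ , _} eq =
  cong₂ _,_ (toℕ-injective (cong proj₁ eq)) (toℕ-injective (cong proj₂ eq))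

toCell-inGrid : ∀ {m n} (u : Vtx m n) → InGrid m n (toCell u)
toCell-inGrid (i , j) = toℕ<n i , toℕ<n j

dist1⇒ : ∀ a b → T (dist1 a b) → a ≡ suc b ⊎ suc a ≡ b
dist1⇒ a b h with Equivalence.to (T-∨ {⌊ a ≟ suc b ⌋}) h
... | inj₁ a≡1+b = inj₁ (toWitness a≡1+b)
... | inj₂ 1+a≡b = inj₂ (toWitness 1+a≡b)

dist1⇐ : ∀ {a b} → a ≡ suc b ⊎ suc a ≡ b → T (dist1 a b)
dist1⇐ {a} {b} (inj₁ a≡1+b) = Equivalence.from (T-∨ {⌊ a ≟ suc b ⌋}) (inj₁ (fromWitness a≡1+b))
dist1⇐ {a} {b} (inj₂ 1+a≡b) = Equivalence.from (T-∨ {⌊ a ≟ suc b ⌋}) (inj₂ (fromWitness 1+a≡b))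

adj⇒Adjacent : ∀ {m n} (u w : Vtx m n) → T (adj u w) → Adjacent (toCell u) (toCell w)
adj⇒Adjacent (i , j) (i′ , j′) h with Equivalence.to T-∨ h
... | inj₁ vertical with Equivalence.to T-∧ vertical
...   | d , e with dist1⇒ (toℕ i) (toℕ i′) d
...     | inj₁ x = up x (cong toℕ (toWitness e))
...     | inj₂ x = down x (cong toℕ (toWitness e))
adj⇒Adjacent (i , j) (i′ , j′) h | inj₂ horizontal with Equivalence.to T-∧ horizontal
...   | e , d with dist1⇒ (toℕ j) (toℕ j′) d
...     | inj₁ x = left (cong toℕ (toWitness e)) x
...     | inj₂ x = right (cong toℕ (toWitness e)) x

Adjacent⇒adj : ∀ {m n} (u w : Vtx m n) → Adjacent (toCell u) (toCell w) → T (adj u w)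
Adjacent⇒adj (i , j) (i′ , j′) a = Equivalence.from T-∨ (go a)
  where
  vertical = dist1 (toℕ i) (toℕ i′) ∧ ⌊ j F.≟ j′ ⌋
  horizontal = ⌊ i F.≟ i′ ⌋ ∧ dist1 (toℕ j) (toℕ j′)
  go : Adjacent (toCell (i , j)) (toCell (i′ , j′)) → T vertical ⊎ T horizontal
  go (up x e)    = inj₁ (Equivalence.from T-∧ (dist1⇐ (inj₁ x) , fromWitness (toℕ-injective e)))
  go (down x e)  = inj₁ (Equivalence.from T-∧ (dist1⇐ (inj₂ x) , fromWitness (toℕ-injective e)))
  go (left e x)  = inj₂ (Equivalence.from T-∧ (fromWitness (toℕ-injective e) , dist1⇐ (inj₁ x)))
  go (right e x) = inj₂ (Equivalence.from T-∧ (fromWitness (toℕ-injective e) , dist1⇐ (inj₂ x)))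

anyF⇒∃ : ∀ {N} (f : Fin N → Bool) → T (anyF f) → ∃ λ x → T (f x)
anyF⇒∃ {suc N} f h with Equivalence.to (T-∨ {f F.zero}) h
... | inj₁ f0 = F.zero , f0
... | inj₂ rest = let (x , fx) = anyF⇒∃ (f ∘ F.suc) rest in F.suc x , fx

∃⇒anyF : ∀ {N} (f : Fin N → Bool) x → T (f x) → T (anyF f)
∃⇒anyF f F.zero    fx = Equivalence.from T-∨ (inj₁ fx)
∃⇒anyF f (F.suc x) fx = Equivalence.from (T-∨ {f F.zero}) (inj₂ (∃⇒anyF (f ∘ F.suc) x fx))

occupied⇒∃ : ∀ {m n s} (p : Fin s → Vtx m n) u → T (occupied p u) → ∃ λ σ → p σ ≡ u
occupied⇒∃ p u h = let (σ , eq) = anyF⇒∃ _ h in σ , toWitness eq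

∃⇒occupied : ∀ {m n s} (p : Fin s → Vtx m n) {u} σ → p σ ≡ u → T (occupied p u)
∃⇒occupied p {u} σ eq = ∃⇒anyF (λ σ′ → ⌊ p σ′ ≟V u ⌋) σ (fromWitness eq)

-- Schedules

module _ (m n : ℕ) (τ : Cell → ℕ) where

  OthersProtected : Cell → Cell → ℕ → Set
  OthersProtected v w t = ∀ w′ → InGrid m n w′ → Adjacent v w′ → w′ ≢ w → τ w′ ≤ t

  data Stuck (v : Cell) (t : ℕ) : Set where
    noUnprotectedNeighbour : (∀ w → InGrid m n w → Adjacent v w → τ w ≤ t) → Stuck v t
    twoUnprotectedNeighbours : ∀ {w w′} → InGrid m n w → InGrid m n w′ →
      Adjacent v w → Adjacent v w′ → w ≢ w′ → t < τ w → t < τ w′ → Stuck v t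

module _ (k m n : ℕ) (τ : Cell → ℕ) (path : ℕ → Cell) (steps : ℕ → ℕ) where

  data Stage (t : ℕ) : Set where
    stay : path (suc t) ≡ path t → steps (suc t) ≡ steps t →
           (steps t < k → Stuck m n τ (path t) t) → Stage t
    advance : steps t < k → steps (suc t) ≡ suc (steps t) →
              Adjacent (path t) (path (suc t)) → t < τ (path (suc t)) →
              OthersProtected m n τ (path t) (path (suc t)) t → Stage t

module _ {k m n : ℕ} {τ : Cell → ℕ} {path : ℕ → Cell} {steps : ℕ → ℕ} where

  stay-at : ∀ {t v} → path t ≡ v → path (suc t) ≡ v →
            steps (suc t) ≡ steps t → (steps t < k → Stuck m n τ v t) → Stage k m n τ path steps t
  stay-at refl stays same stuck = stay stays same stuck

  advance-from : ∀ {t v w} → path t ≡ v → path (suc t) ≡ w →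
                 steps t < k → steps (suc t) ≡ suc (steps t) →
                 Adjacent v w → t < τ w → OthersProtected m n τ v w t → Stage k m n τ path steps t
  advance-from refl refl = advance

record Trajectory (k m n : ℕ) (τ : Cell → ℕ) : Set where
  field
    path        : ℕ → Cell
    steps       : ℕ → ℕ
    path-inGrid : ∀ t → InGrid m n (path t)
    steps-0     : steps 0 ≡ 0
    τ-path≤     : ∀ t → τ (path t) ≤ t
    stage       : ∀ t → Stage k m n τ path steps t

-- τ u is the stage at which u becomes protected.
record Schedule (k m n : ℕ) : Set₁ where
  field
    Searcher       : Set
    count          : ℕ
    enumeration    : Fin count ↔ Searcher
    τ              : Cell → ℕ
    end            : ℕ
    τ≤end          : ∀ u → InGrid m n u → τ u ≤ end
    trajectory     : Searcher → Trajectory k m n τ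
  open module Of σ = Trajectory (trajectory σ) public
  field
    visited-at-τ   : ∀ u → InGrid m n u → ∃ λ σ → path σ (τ u) ≡ u
    path-injective : ∀ σ σ′ t → path σ t ≡ path σ′ t → σ ≡ σ′

T-not⇒¬T : ∀ {b} → T (not b) → ¬ T b
T-not⇒¬T {false} _ ()

¬T⇒T-not : ∀ {b} → ¬ T b → T (not b)
¬T⇒T-not {true}  ¬b = ¬b tt
¬T⇒T-not {false} _  = tt

module Play {k m n : ℕ} (S : Schedule k m n) where
  open Schedule S

  label : Fin count → Searcher
  label = Inverse.to enumeration

  label-injective : ∀ {σ σ′} → label σ ≡ label σ′ → σ ≡ σ′
  label-injective = Injection.injective (↔⇒↣ enumeration)

  at : ℕ → Fin count → Cell
  at t σ = path (label σ) t

  layout : ℕ → Fin count → Vtx m n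
  layout t σ = fromCell (at t σ) (path-inGrid (label σ) t)

  toCell-layout : ∀ t σ → toCell (layout t σ) ≡ at t σ
  toCell-layout t σ = toCell-fromCell (at t σ) (path-inGrid (label σ) t)

  layout≡⇒at≡ : ∀ {t σ u} → layout t σ ≡ u → at t σ ≡ toCell u
  layout≡⇒at≡ {t} {σ} eq = trans (sym (toCell-layout t σ)) (cong toCell eq)

  protectedBy : ℕ → Vtx m n → Bool
  protectedBy zero    = occupied (layout 0)
  protectedBy (suc t) u = protectedBy t u ∨ occupied (layout (suc t)) u

  movesBy : ℕ → Fin count → ℕ
  movesBy zero    _ = 0
  movesBy (suc t) σ = steps (label σ) (suc t)

  movesBy≡steps : ∀ t σ → movesBy t σ ≡ steps (label σ) t
  movesBy≡steps zero    σ = sym (steps-0 (label σ))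
  movesBy≡steps (suc t) σ = refl

  state : ℕ → State m n count
  state t = record { pos = layout t ; moves = movesBy t ; prot = protectedBy t }

  occupied⇒τ≤ : ∀ t u → T (occupied (layout t) u) → τ (toCell u) ≤ t
  occupied⇒τ≤ t u h =
    let (σ , eq) = occupied⇒∃ (layout t) u h
    in subst (λ v → τ v ≤ t) (layout≡⇒at≡ eq) (τ-path≤ (label σ) t)

  protected⇒τ≤ : ∀ t u → T (protectedBy t u) → τ (toCell u) ≤ t
  protected⇒τ≤ zero    u h = occupied⇒τ≤ 0 u h
  protected⇒τ≤ (suc t) u h with Equivalence.to (T-∨ {protectedBy t u}) h
  ... | inj₁ before = m≤n⇒m≤1+n (protected⇒τ≤ t u before)
  ... | inj₂ now    = occupied⇒τ≤ (suc t) u now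

  occupied⇒protected : ∀ t u → T (occupied (layout t) u) → T (protectedBy t u)
  occupied⇒protected zero    u h = h
  occupied⇒protected (suc t) u h = Equivalence.from (T-∨ {protectedBy t u}) (inj₂ h)

  protectedBy-mono : ∀ {t t′} u → t ≤′ t′ → T (protectedBy t u) → T (protectedBy t′ u)
  protectedBy-mono u ≤′-refl        h = h
  protectedBy-mono u (≤′-step t≤t′) h = Equivalence.from T-∨ (inj₁ (protectedBy-mono u t≤t′ h))

  τ≤⇒protected : ∀ t u → τ (toCell u) ≤ t → T (protectedBy t u)
  τ≤⇒protected t u τ≤t = protectedBy-mono u (≤⇒≤′ τ≤t) (occupied⇒protected _ u visited)
    where
    x = proj₁ (visited-at-τ (toCell u) (toCell-inGrid u))
    σ = Inverse.from enumeration x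
    visited : T (occupied (layout (τ (toCell u))) u)
    visited = ∃⇒occupied _ σ (toCell-injective (begin
      toCell (layout _ σ)      ≡⟨ toCell-layout _ σ ⟩
      path (label σ) _         ≡⟨ cong (λ y → path y _) (Inverse.strictlyInverseˡ enumeration x) ⟩
      path x _                 ≡⟨ proj₂ (visited-at-τ (toCell u) (toCell-inGrid u)) ⟩
      toCell u                 ∎))
      where open ≡-Reasoning

  unprotected-neighbour : ∀ t σ u → T (unprotNbr k (state t) (layout t σ) u) →
                          Adjacent (at t σ) (toCell u) × t < τ (toCell u)
  unprotected-neighbour t σ u h =
    let (adjacent , unprotected) = Equivalence.to T-∧ h
    in subst (λ x → Adjacent x (toCell u)) (toCell-layout t σ) (adj⇒Adjacent _ u adjacent)
     , ≰⇒> (T-not⇒¬T unprotected ∘ τ≤⇒protected t u)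

  unprotected-cell : ∀ t σ w (w∈ : InGrid m n w) → Adjacent (at t σ) w → t < τ w →
                     T (unprotNbr k (state t) (layout t σ) (fromCell w w∈))
  unprotected-cell t σ w w∈ at~w t<τw = Equivalence.from T-∧
    ( Adjacent⇒adj (layout t σ) _ (subst₂ Adjacent (sym (toCell-layout t σ)) (sym w≡) at~w)
    , ¬T⇒T-not (<⇒≱ (subst (λ x → t < τ x) (sym w≡) t<τw) ∘ protected⇒τ≤ t _))
    where w≡ = toCell-fromCell w w∈

  mobile⇒ : ∀ t σ → T (mobileB k (state t) σ) → steps (label σ) t < k
  mobile⇒ t σ h = subst (_< k) (movesBy≡steps t σ) (toWitness h)

  ⇒mobile : ∀ t σ → steps (label σ) t < k → T (mobileB k (state t) σ)
  ⇒mobile t σ lt = fromWitness (subst (_< k) (sym (movesBy≡steps t σ)) lt)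

  #mobile≤1 : ∀ t v → #mobile k (state t) v ≤ 1
  #mobile≤1 t v = countF-≤1 _ λ σ σ′ hσ hσ′ →
    label-injective (path-injective _ _ t
      (trans (layout≡⇒at≡ (here σ hσ)) (sym (layout≡⇒at≡ (here σ′ hσ′)))))
    where
    here : ∀ σ → T (⌊ layout t σ ≟V v ⌋ ∧ mobileB k (state t) σ) → layout t σ ≡ v
    here σ h = toWitness (proj₁ (Equivalence.to (T-∧ {⌊ layout t σ ≟V v ⌋}) h))

  onlyUnprotected : ∀ t σ → OthersProtected m n τ (at t σ) (at (suc t) σ) t →
                    ∀ u → T (unprotNbr k (state t) (layout t σ) u) → u ≡ layout (suc t) σ
  onlyUnprotected t σ others u h with u ≟V layout (suc t) σ
  ... | yes u≡next = u≡next
  ... | no  u≢next =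
    let (at~u , t<τu) = unprotected-neighbour t σ u h
    in ⊥-elim (<⇒≱ t<τu (others (toCell u) (toCell-inGrid u) at~u
         (λ eq → u≢next (toCell-injective (trans eq (sym (toCell-layout (suc t) σ)))))))

  searcherMove : ∀ t σ → Stage k m n τ (path (label σ)) (steps (label σ)) t →
    (layout (suc t) σ ≡ layout t σ × movesBy (suc t) σ ≡ movesBy t σ)
    ⊎ (T (mobileB k (state t) σ) × Active k (state t) (layout t σ)
       × T (unprotNbr k (state t) (layout t σ) (layout (suc t) σ))
       × movesBy (suc t) σ ≡ suc (movesBy t σ))
  searcherMove t σ (stay stays same _) =
    inj₁ ( toCell-injective (trans (toCell-layout (suc t) σ) (trans stays (sym (toCell-layout t σ))))
         , trans same (sym (movesBy≡steps t σ)))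
  searcherMove t σ (advance mobile inc step fresh others) =
    inj₂ (⇒mobile t σ mobile , (1≤#unprot , #unprot≤#mobile) , next-unprotected
         , trans inc (cong suc (sym (movesBy≡steps t σ))))
    where
    next-unprotected : T (unprotNbr k (state t) (layout t σ) (layout (suc t) σ))
    next-unprotected = unprotected-cell t σ (at (suc t) σ) (path-inGrid (label σ) (suc t)) step fresh
    1≤#unprot : 1 ≤ #unprot k (state t) (layout t σ)
    1≤#unprot = countV-≥1 (unprotNbr k (state t) (layout t σ)) _ next-unprotected
    #unprot≤#mobile : #unprot k (state t) (layout t σ) ≤ #mobile k (state t) (layout t σ)
    #unprot≤#mobile = ≤-trans
      (countV-≤1 _ λ u w hu hw → trans (onlyUnprotected t σ others u hu) (sym (onlyUnprotected t σ others w hw)))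
      (countF-≥1 _ σ (Equivalence.from T-∧ (fromWitness refl , ⇒mobile t σ mobile)))

  firing-searcher-covers : ∀ t σ → steps (label σ) t < k → Active k (state t) (layout t σ) →
    Stage k m n τ (path (label σ)) (steps (label σ)) t →
    ∀ u → T (unprotNbr k (state t) (layout t σ) u) → layout (suc t) σ ≡ u
  firing-searcher-covers t σ mobile _ (advance _ _ _ _ others) u hu = sym (onlyUnprotected t σ others u hu)
  firing-searcher-covers t σ mobile (_ , #unprot≤#mobile) (stay _ _ stuck) u hu with stuck mobile
  ... | noUnprotectedNeighbour protected =
    let (at~u , t<τu) = unprotected-neighbour t σ u hu
    in ⊥-elim (<⇒≱ t<τu (protected (toCell u) (toCell-inGrid u) at~u))
  ... | twoUnprotectedNeighbours {w} {w′} w∈ w′∈ at~w at~w′ w≢w′ t<τw t<τw′ =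
    ⊥-elim (<⇒≱ (s≤s (s≤s z≤n)) (≤-trans 2≤#unprot (≤-trans #unprot≤#mobile (#mobile≤1 t (layout t σ)))))
    where
    2≤#unprot : 2 ≤ #unprot k (state t) (layout t σ)
    2≤#unprot = countV-≥2 _
      (λ eq → w≢w′ (trans (sym (toCell-fromCell w w∈)) (trans (cong toCell eq) (toCell-fromCell w′ w′∈))))
      (unprotected-cell t σ w w∈ at~w t<τw) (unprotected-cell t σ w′ w′∈ at~w′ t<τw′)

  cover : ∀ t v → Active k (state t) v → ∀ u → T (unprotNbr k (state t) v u) →
          ∃ λ σ → layout t σ ≡ v × layout (suc t) σ ≡ u
  cover t v active u hu =
    let (σ , hσ) = countF-≥1⇒∃ _ (≤-trans (proj₁ active) (proj₂ active))
        (at-v , mobile) = Equivalence.to (T-∧ {⌊ layout t σ ≟V v ⌋}) hσ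
    in σ , toWitness at-v , covers σ (toWitness at-v) (mobile⇒ t σ mobile)
    where
    covers : ∀ σ → layout t σ ≡ v → steps (label σ) t < k → layout (suc t) σ ≡ u
    covers σ refl mobile = firing-searcher-covers t σ mobile active (stage (label σ) t) u hu

  step : ∀ t → Step k (state t) (state (suc t))
  step t = record
    { searcherMove = λ σ → searcherMove t σ (stage (label σ) t)
    ; cover        = cover t
    ; protUpdate   = λ _ → refl
    }

  play : ∀ t → Star (Step k) (state 0) (state t)
  play zero    = ε
  play (suc t) = play t ◅◅ (step t ◅ ε)

  successful : Successful k (layout 0)
  successful = state end , play end , λ u → τ≤⇒protected end u (τ≤end (toCell u) (toCell-inGrid u))

schedule⇒dk≤ : ∀ {k m n B} (S : Schedule k m n) → Schedule.count S ≤ B → dk≤ k m n B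
schedule⇒dk≤ S count≤B = Schedule.count S , count≤B , Play.layout S 0 , Play.successful S

-- Transposition

InGrid-swap : ∀ {m n} u → InGrid n m u → InGrid m n (swap u)
InGrid-swap (i , j) = swap

Adjacent-swap : ∀ {u w} → Adjacent u w → Adjacent (swap u) (swap w)
Adjacent-swap (up x e)    = left e x
Adjacent-swap (down x e)  = right e x
Adjacent-swap (left e x)  = up x e
Adjacent-swap (right e x) = down x e

module _ {m n : ℕ} {τ : Cell → ℕ} where

  OthersProtected-swap : ∀ {v w t} → OthersProtected n m τ v w t →
                         OthersProtected m n (τ ∘ swap) (swap v) (swap w) t
  OthersProtected-swap others w′ w′∈ v~w′ w′≢w =
    others (swap w′) (InGrid-swap w′ w′∈) (Adjacent-swap v~w′) (w′≢w ∘ cong swap)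

  Stuck-swap : ∀ {v t} → Stuck n m τ v t → Stuck m n (τ ∘ swap) (swap v) t
  Stuck-swap (noUnprotectedNeighbour protected) =
    noUnprotectedNeighbour λ w w∈ v~w → protected (swap w) (InGrid-swap w w∈) (Adjacent-swap v~w)
  Stuck-swap (twoUnprotectedNeighbours {w} {w′} w∈ w′∈ v~w v~w′ w≢w′ t<τw t<τw′) =
    twoUnprotectedNeighbours (InGrid-swap w w∈) (InGrid-swap w′ w′∈) (Adjacent-swap v~w) (Adjacent-swap v~w′)
      (w≢w′ ∘ cong swap) t<τw t<τw′

transpose-trajectory : ∀ {k m n τ} → Trajectory k n m τ → Trajectory k m n (τ ∘ swap)
transpose-trajectory {k} {m} {n} {τ} tr = record
  { path        = swap ∘ path
  ; steps       = steps
  ; path-inGrid = λ t → InGrid-swap (path t) (path-inGrid t)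
  ; steps-0     = steps-0
  ; τ-path≤     = τ-path≤
  ; stage       = stage′
  }
  where
  open Trajectory tr
  stage′ : ∀ t → Stage k m n (τ ∘ swap) (swap ∘ path) steps t
  stage′ t with stage t
  ... | stay stays same stuck = stay (cong swap stays) same (Stuck-swap ∘ stuck)
  ... | advance mobile inc step fresh others =
    advance mobile inc (Adjacent-swap step) fresh (OthersProtected-swap others)

transpose : ∀ {k m n} → Schedule k n m → Schedule k m n
transpose S = record
  { Searcher       = Searcher
  ; count          = count
  ; enumeration    = enumeration
  ; τ              = τ ∘ swap
  ; end            = end
  ; τ≤end          = λ u u∈ → τ≤end (swap u) (InGrid-swap u u∈)
  ; trajectory     = transpose-trajectory ∘ trajectory
  ; visited-at-τ   = λ u u∈ → let (σ , eq) = visited-at-τ (swap u) (InGrid-swap u u∈) in σ , cong swap eq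
  ; path-injective = λ σ σ′ t eq → path-injective σ σ′ t (cong swap eq)
  }
  where open Schedule S

-- A walker that takes its e-th step at stage L e

module Walk (k : ℕ) (L : ℕ → ℕ) (L-0 : L 0 ≡ 0) (L-< : ∀ e → e < k → L e < L (suc e)) where

  L-mono-≤ : ∀ {e e′} → e ≤′ e′ → e′ ≤ k → L e ≤ L e′
  L-mono-≤ ≤′-refl           _    = ≤-refl
  L-mono-≤ (≤′-step {e″} e≤e″) e″<k = ≤-trans (L-mono-≤ e≤e″ (<⇒≤ e″<k)) (<⇒≤ (L-< e″ e″<k))

  L-mono-< : ∀ {e e′} → e < e′ → e′ ≤ k → L e < L e′
  L-mono-< {e} e<e′ e′≤k = <-≤-trans (L-< e (<-≤-trans e<e′ e′≤k)) (L-mono-≤ (≤⇒≤′ e<e′) e′≤k)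

  deeper : ℕ → ℕ → ℕ
  deeper t d with d <? k | L (suc d) ≤? suc t
  ... | yes _ | yes _ = suc d
  ... | _     | _     = d

  depth : ℕ → ℕ
  depth zero    = 0
  depth (suc t) = deeper t (depth t)

  data DepthStep (t d d′ : ℕ) : Set where
    descend : d < k → L (suc d) ≤ suc t → d′ ≡ suc d → DepthStep t d d′
    wait    : d < k → suc t < L (suc d) → d′ ≡ d → DepthStep t d d′
    bottom  : ¬ d < k → d′ ≡ d → DepthStep t d d′

  deeper-step : ∀ t d → DepthStep t d (deeper t d)
  deeper-step t d with d <? k | L (suc d) ≤? suc t
  ... | yes d<k | yes due   = descend d<k due refl
  ... | yes d<k | no notDue = wait d<k (≰⇒> notDue) refl
  ... | no d≮k  | _         = bottom d≮k refl

  depth-step : ∀ t → DepthStep t (depth t) (depth (suc t))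
  depth-step t = deeper-step t (depth t)

  record DepthInvariant (t : ℕ) : Set where
    field
      arrived : L (depth t) ≤ t
      depth≤k : depth t ≤ k
      pending : depth t < k → t < L (suc (depth t))

  depth-invariant : ∀ t → DepthInvariant t
  depth-invariant zero = record
    { arrived = ≤-reflexive L-0
    ; depth≤k = z≤n
    ; pending = λ 0<k → subst (_< L 1) L-0 (L-< 0 0<k)
    }
  depth-invariant (suc t) with depth-step t | depth-invariant t
  ... | descend d<k due eq | inv = record
    { arrived = subst (λ d → L d ≤ suc t) (sym eq) due
    ; depth≤k = subst (_≤ k) (sym eq) d<k
    ; pending = λ d′<k → subst (_< L (suc (depth (suc t)))) arrival
                           (L-< (depth (suc t)) d′<k)
    }
    where
    open DepthInvariant inv
    arrival : L (depth (suc t)) ≡ suc t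
    arrival = trans (cong L eq) (≤-antisym due (pending d<k))
  ... | wait d<k notDue eq | inv = record
    { arrived = subst (λ d → L d ≤ suc t) (sym eq) (m≤n⇒m≤1+n arrived)
    ; depth≤k = subst (_≤ k) (sym eq) depth≤k
    ; pending = λ _ → subst (λ d → suc t < L (suc d)) (sym eq) notDue
    }
    where open DepthInvariant inv
  ... | bottom d≮k eq | inv = record
    { arrived = subst (λ d → L d ≤ suc t) (sym eq) (m≤n⇒m≤1+n arrived)
    ; depth≤k = subst (_≤ k) (sym eq) depth≤k
    ; pending = λ d′<k → ⊥-elim (d≮k (subst (_< k) eq d′<k))
    }
    where open DepthInvariant inv

  open module Invariant t = DepthInvariant (depth-invariant t) public

  depth-L : ∀ e → e ≤ k → depth (L e) ≡ e
  depth-L e e≤k with <-cmp (depth (L e)) e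
  ... | tri≈ _ eq _ = eq
  ... | tri< d<e _ _ = ⊥-elim (<⇒≱ (pending (L e) (<-≤-trans d<e e≤k)) (L-mono-≤ (≤⇒≤′ d<e) e≤k))
  ... | tri> _ _ e<d = ⊥-elim (<⇒≱ (L-mono-< e<d (depth≤k (L e))) (arrived (L e)))

module _ (n : ℕ) .{{_ : NonZero n}} where

  [m*n+o]%n≡o : ∀ m {o} → o < n → (m * n + o) % n ≡ o
  [m*n+o]%n≡o m {o} o<n = trans (%-remove-+ˡ o (n∣m*n m)) (m<n⇒m%n≡m o<n)

  [m*n+o]/n≡m : ∀ m {o} → o < n → (m * n + o) / n ≡ m
  [m*n+o]/n≡m m {o} o<n = begin
    (m * n + o) / n   ≡⟨ +-distrib-/-∣ˡ o (n∣m*n m) ⟩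
    m * n / n + o / n ≡⟨ cong₂ _+_ (m*n/n≡m m n) (m<n⇒m/n≡0 o<n) ⟩
    m + 0             ≡⟨ +-identityʳ m ⟩
    m                 ∎
    where open ≡-Reasoning

  [m*n+o]≡[p*n+q]⇒m≡p : ∀ {m o p q} → o < n → q < n → m * n + o ≡ p * n + q → m ≡ p
  [m*n+o]≡[p*n+q]⇒m≡p {m} {o} {p} {q} o<n q<n eq =
    trans (sym ([m*n+o]/n≡m m o<n)) (trans (cong (_/ n) eq) ([m*n+o]/n≡m p q<n))

  m≡[m/n]*n+m%n : ∀ m → m ≡ m / n * n + m % n
  m≡[m/n]*n+m%n m = trans (m≡m%n+[m/n]*n m n) (+-comm (m % n) _)

searcher-count : ∀ K q₁ r₁ q₂ r₂ .{{_ : NonZero K}} →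
  q₁ * (r₂ + q₂ * K) + r₁ * suc q₂ ≡ ((r₁ + q₁ * K) * (r₂ + q₂ * K) ∸ r₁ * r₂) / K + r₁
searcher-count K q₁ r₁ q₂ r₂ = begin
  q₁ * (r₂ + q₂ * K) + r₁ * suc q₂                   ≡⟨ count≡ q₁ r₁ q₂ r₂ K ⟩
  X + r₁                                             ≡⟨ cong (_+ r₁) (sym (m*n/n≡m X K)) ⟩
  X * K / K + r₁
    ≡⟨ cong (λ x → x / K + r₁) (sym (m+n∸m≡n (r₁ * r₂) (X * K))) ⟩
  (r₁ * r₂ + X * K ∸ r₁ * r₂) / K + r₁
    ≡⟨ cong (λ x → (x ∸ r₁ * r₂) / K + r₁) (sym (product≡ q₁ r₁ q₂ r₂ K)) ⟩
  ((r₁ + q₁ * K) * (r₂ + q₂ * K) ∸ r₁ * r₂) / K + r₁ ∎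
  where
  open ≡-Reasoning
  X = q₁ * q₂ * K + q₁ * r₂ + r₁ * q₂
  count≡ : ∀ q₁ r₁ q₂ r₂ K →
           q₁ * (r₂ + q₂ * K) + r₁ * suc q₂ ≡ (q₁ * q₂ * K + q₁ * r₂ + r₁ * q₂) + r₁
  count≡ = solve-∀
  product≡ : ∀ q₁ r₁ q₂ r₂ K →
             (r₁ + q₁ * K) * (r₂ + q₂ * K) ≡ r₁ * r₂ + (q₁ * q₂ * K + q₁ * r₂ + r₁ * q₂) * K
  product≡ = solve-∀

-- The construction, for m ≡ r₁ + q₁ (k + 1) and n ≡ r₂ + q₂ (k + 1) with r₁ ≤ r₂

module Construction (k m n : ℕ) (1≤k : 1 ≤ k) (r₁≤r₂ : m % suc k ≤ n % suc k) where

  K q₁ r₁ q₂ r₂ : ℕ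
  K  = suc k
  q₁ = m / K
  r₁ = m % K
  q₂ = n / K
  r₂ = n % K

  m≡ : m ≡ r₁ + q₁ * K
  m≡ = m≡m%n+[m/n]*n m K

  n≡ : n ≡ r₂ + q₂ * K
  n≡ = m≡m%n+[m/n]*n n K

  r₂<K : r₂ < K
  r₂<K = m%n<n n K

  -- The searcher of segment c leaves its first cell r₂ + c K at stage departure c, when the last
  -- cell of the previous segment is protected, and reaches offset e at stage arrival c e.
  departure : ℕ → ℕ
  departure c = r₂ ∸ 1 + c * k

  arrival : ℕ → ℕ → ℕ
  arrival c zero    = 0
  arrival c (suc e) = departure c + suc e

  stripτ : ℕ → ℕ
  stripτ j with j <? r₂
  ... | yes _ = j
  ... | no  _ = arrival ((j ∸ r₂) / K) ((j ∸ r₂) % K)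

  stripτ-initial : ∀ {j} → j < r₂ → stripτ j ≡ j
  stripτ-initial {j} j<r₂ with j <? r₂
  ... | yes _    = refl
  ... | no  j≮r₂ = ⊥-elim (j≮r₂ j<r₂)

  stripτ-segment : ∀ c {e} → e < K → stripτ (r₂ + c * K + e) ≡ arrival c e
  stripτ-segment c {e} e<K with r₂ + c * K + e <? r₂
  ... | yes j<r₂ = ⊥-elim (<⇒≱ j<r₂ (≤-trans (m≤m+n r₂ (c * K)) (m≤m+n _ e)))
  ... | no  _    = cong₂ arrival (trans (cong (_/ K) offset) ([m*n+o]/n≡m K c e<K))
                                 (trans (cong (_% K) offset) ([m*n+o]%n≡o K c e<K))
    where
    offset : r₂ + c * K + e ∸ r₂ ≡ c * K + e
    offset = trans (cong (_∸ r₂) (+-assoc r₂ (c * K) e)) (m+n∸m≡n r₂ (c * K + e))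

  arrival≤ : ∀ c e → arrival c e ≤ r₂ + c * K + e
  arrival≤ c zero    = z≤n
  arrival≤ c (suc e) = +-monoˡ-≤ (suc e) (+-mono-≤ (m∸n≤m r₂ 1) (*-monoʳ-≤ c (n≤1+n k)))

  arrival-pos : ∀ c {e} → 1 ≤ e → arrival c e ≡ departure c + e
  arrival-pos c {suc e} _ = refl

  segment-end : ∀ c → suc (r₂ + c * K + k) ≡ r₂ + suc c * K
  segment-end c = trans (sym (+-suc (r₂ + c * K) k)) (trans (+-assoc r₂ (c * K) K) (cong (r₂ +_) (+-comm (c * K) K)))

  stripτ≤ : ∀ j → stripτ j ≤ j
  stripτ≤ j with j <? r₂
  ... | yes _    = ≤-refl
  ... | no  j≮r₂ = subst (arrival c e ≤_) j≡ (arrival≤ c e)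
    where
    c = (j ∸ r₂) / K
    e = (j ∸ r₂) % K
    j≡ : r₂ + c * K + e ≡ j
    j≡ = trans (+-assoc r₂ (c * K) e)
        (trans (cong (r₂ +_) (sym (m≡[m/n]*n+m%n K (j ∸ r₂)))) (m+[n∸m]≡n (≮⇒≥ j≮r₂)))

  topτ : ℕ → ℕ
  topτ j with r₁ ≟ 0
  ... | yes _ = 0
  ... | no  _ = stripτ j

  -- At the border, j ∸ 1 and right-of j fall back to j itself, which leaves readyτ unchanged.
  right-of : ℕ → ℕ
  right-of j = suc j ⊓ (n ∸ 1)

  -- columnτ b e j is the stage at which the searcher of band b in column j reaches depth e;
  -- it moves on at stage readyτ b e j, once all its other neighbours are protected.
  mutual
    columnτ : ℕ → ℕ → ℕ → ℕ
    columnτ b zero    j = 0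
    columnτ b (suc e) j = suc (readyτ b e j)

    readyτ : ℕ → ℕ → ℕ → ℕ
    readyτ b e j = columnτ b e j ⊔ aboveτ b e j ⊔ columnτ b e (j ∸ 1) ⊔ columnτ b e (right-of j)

    aboveτ : ℕ → ℕ → ℕ → ℕ
    aboveτ b       (suc e) j = columnτ b e j
    aboveτ zero    zero    j = topτ j
    aboveτ (suc b) zero    j = columnτ b k j

  bandRow : ℕ → ℕ → ℕ
  bandRow b e = r₁ + (b * K + e)

  bandRow-suc : ∀ b e → bandRow b (suc e) ≡ suc (bandRow b e)
  bandRow-suc b e = trans (cong (r₁ +_) (+-suc (b * K) e)) (+-suc r₁ _)

  bandRow-next : ∀ b → bandRow (suc b) 0 ≡ suc (bandRow b k)
  bandRow-next b = trans (cong (r₁ +_) (trans (+-identityʳ _) (+-comm K (b * K)))) (bandRow-suc b k)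

  τ : Cell → ℕ
  τ (i , j) with i <? r₁
  ... | yes _ = stripτ j
  ... | no  _ = columnτ ((i ∸ r₁) / K) ((i ∸ r₁) % K) j

  τ-strip : ∀ {i} j → i < r₁ → τ (i , j) ≡ stripτ j
  τ-strip {i} j i<r₁ with i <? r₁
  ... | yes _    = refl
  ... | no  i≮r₁ = ⊥-elim (i≮r₁ i<r₁)

  τ-band : ∀ b {e} j → e < K → τ (bandRow b e , j) ≡ columnτ b e j
  τ-band b {e} j e<K with bandRow b e <? r₁
  ... | yes row<r₁ = ⊥-elim (<⇒≱ row<r₁ (m≤m+n r₁ _))
  ... | no  _      = cong₂ (λ b′ e′ → columnτ b′ e′ j)
                       (trans (cong (_/ K) offset) ([m*n+o]/n≡m K b e<K))
                       (trans (cong (_% K) offset) ([m*n+o]%n≡o K b e<K))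
    where
    offset : bandRow b e ∸ r₁ ≡ b * K + e
    offset = m+n∸m≡n r₁ (b * K + e)

  τ-band₀ : ∀ j → τ (r₁ , j) ≡ 0
  τ-band₀ j = trans (cong (λ i → τ (i , j)) (sym (+-identityʳ r₁))) (τ-band 0 j (s≤s z≤n))

  τ≤stripτ : ∀ {c} j → c ≤ r₁ → τ (c , j) ≤ stripτ j
  τ≤stripτ {c} j c≤r₁ with m≤n⇒m<n∨m≡n c≤r₁
  ... | inj₁ c<r₁ = ≤-reflexive (τ-strip j c<r₁)
  ... | inj₂ refl = subst (_≤ stripτ j) (sym (τ-band₀ j)) z≤n

  τ-above : ∀ b e {c} j → e < K → suc c ≡ bandRow b e → τ (c , j) ≡ aboveτ b e j
  τ-above zero zero {c} j _ 1+c≡r₁ with r₁ ≟ 0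
  ... | yes r₁≡0 = ⊥-elim (0≢1+n (trans (sym r₁≡0) (trans (sym (+-identityʳ r₁)) (sym 1+c≡r₁))))
  ... | no  _    = τ-strip j (≤-reflexive (trans 1+c≡r₁ (+-identityʳ r₁)))
  τ-above (suc b) zero {c} j _ 1+c≡row =
    trans (cong (λ i → τ (i , j)) (suc-injective (trans 1+c≡row (bandRow-next b)))) (τ-band b j ≤-refl)
  τ-above b (suc e) {c} j e<K 1+c≡row =
    trans (cong (λ i → τ (i , j)) (suc-injective (trans 1+c≡row (bandRow-suc b e)))) (τ-band b j (<-trans (n<1+n e) e<K))

  topτ≤stripτ : ∀ j → topτ j ≤ stripτ j
  topτ≤stripτ j with r₁ ≟ 0
  ... | yes _ = z≤n
  ... | no  _ = ≤-refl

  right-of<n : ∀ {j} → j < n → right-of j < n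
  right-of<n {j} j<n = <-≤-trans (s≤s (m⊓n≤n (suc j) (n ∸ 1))) (≤-reflexive (m+[n∸m]≡n (≤-trans (s≤s z≤n) j<n)))

  mutual
    columnτ≤ : ∀ b e {j} → j < n → columnτ b e j ≤ n + (b * K + e)
    columnτ≤ b zero    j<n = z≤n
    columnτ≤ b (suc e) {j} j<n =
      subst (suc (readyτ b e j) ≤_) (sym (trans (cong (n +_) (+-suc (b * K) e)) (+-suc n _))) (s≤s (⊔-lub (⊔-lub (⊔-lub (columnτ≤ b e j<n) (aboveτ≤ b e j<n))
                         (columnτ≤ b e (≤-<-trans (m∸n≤m j 1) j<n)))
                  (columnτ≤ b e (right-of<n j<n))))

    aboveτ≤ : ∀ b e {j} → j < n → aboveτ b e j ≤ n + (b * K + e)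
    aboveτ≤ b       (suc e) j<n = ≤-trans (columnτ≤ b e j<n) (+-monoʳ-≤ n (+-monoʳ-≤ (b * K) (n≤1+n e)))
    aboveτ≤ zero    zero {j} j<n =
      ≤-trans (topτ≤stripτ j) (≤-trans (stripτ≤ j) (≤-trans (<⇒≤ j<n) (m≤m+n n _)))
    aboveτ≤ (suc b) zero    j<n = ≤-trans (columnτ≤ b k j<n)
      (+-monoʳ-≤ n (≤-trans (≤-reflexive (+-comm (b * K) k))
                             (≤-trans (+-monoˡ-≤ (b * K) (n≤1+n k)) (m≤m+n _ 0))))

  τ≤n+m : ∀ u → InGrid m n u → τ u ≤ n + m
  τ≤n+m (i , j) (i<m , j<n) with i <? r₁
  ... | yes _ = ≤-trans (stripτ≤ j) (≤-trans (<⇒≤ j<n) (m≤m+n n m))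
  ... | no  _ = ≤-trans (columnτ≤ (d / K) (d % K) j<n)
                  (+-monoʳ-≤ n (≤-trans (≤-reflexive (sym (m≡[m/n]*n+m%n K d)))
                                         (≤-trans (m∸n≤m i r₁) (<⇒≤ i<m))))
    where d = i ∸ r₁

  r₁≤m : r₁ ≤ m
  r₁≤m = subst (r₁ ≤_) (sym m≡) (m≤m+n r₁ _)

  strip-neighbour≤ : ∀ {i j t w} → i < r₁ → stripτ j ≤ t → (∀ {d} → j ≡ suc d → stripτ d ≤ t) →
                     Adjacent (i , j) w → w ≢ (i , suc j) → τ w ≤ t
  strip-neighbour≤ i<r₁ here≤t _ (up {i′ = c} i≡1+c refl) _ =
    ≤-trans (τ≤stripτ _ (≤-trans (n≤1+n c) (subst (_≤ r₁) i≡1+c (<⇒≤ i<r₁)))) here≤t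
  strip-neighbour≤ i<r₁ here≤t _ (down refl refl) _ = ≤-trans (τ≤stripτ _ i<r₁) here≤t
  strip-neighbour≤ i<r₁ _ before≤t (left refl j≡1+d) _ = subst (_≤ _) (sym (τ-strip _ i<r₁)) (before≤t j≡1+d)
  strip-neighbour≤ i<r₁ _ _ (right refl refl) w≢right = ⊥-elim (w≢right refl)

  -- The searcher of a segment waits on its first cell o until stage st, then sweeps the next
  -- len cells.
  record Segment (o st len : ℕ) : Set where
    field
      len≤k      : len ≤ k
      end<n      : o + len < n
      τ-start    : stripτ o ≡ 0
      τ-interior : ∀ e → 1 ≤ e → e ≤ len → stripτ (o + e) ≡ st + e
      τ-before   : 1 ≤ o → stripτ (o ∸ 1) ≡ st
      late⇒inner : 1 ≤ st → 1 ≤ o × 1 ≤ len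
      τ-after    : len < k → o + suc len < n → stripτ (o + suc len) ≡ 0

  module SegmentSearcher {i} (i<r₁ : i < r₁) {o st len} (seg : Segment o st len) where
    open Segment seg

    progress : ℕ → ℕ
    progress t = len ⊓ (t ∸ st)

    path : ℕ → Cell
    path t = i , o + progress t

    path≡ : ∀ {t e} → e ≤ len → t ∸ st ≡ e → path t ≡ (i , o + e)
    path≡ e≤len t∸st≡e = cong (λ p → i , o + p) (trans (cong (len ⊓_) t∸st≡e) (m≥n⇒m⊓n≡n e≤len))

    progress≡ : ∀ {t e} → e ≤ len → t ∸ st ≡ e → progress t ≡ e
    progress≡ e≤len t∸st≡e = trans (cong (len ⊓_) t∸st≡e) (m≥n⇒m⊓n≡n e≤len)

    i<m : i < m
    i<m = ≤-trans i<r₁ r₁≤m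

    swept : ∀ {t e} → e ≤ len → e ≤ t ∸ st → stripτ (o + e) ≤ t
    swept {t} {zero}  _     _       = subst (_≤ t) (sym (trans (cong stripτ (+-identityʳ o)) τ-start)) z≤n
    swept {t} {suc e} e≤len e≤t∸st = begin
      stripτ (o + suc e) ≡⟨ τ-interior (suc e) (s≤s z≤n) e≤len ⟩
      st + suc e         ≤⟨ +-monoʳ-≤ st e≤t∸st ⟩
      st + (t ∸ st)      ≡⟨ m+[n∸m]≡n st≤t ⟩
      t                  ∎
      where
      open ≤-Reasoning
      st≤t : st ≤ t
      st≤t = <⇒≤ (m∸n≢0⇒n<m λ t∸st≡0 → <⇒≱ (s≤s z≤n) (subst (suc e ≤_) t∸st≡0 e≤t∸st))

    before : ∀ {t e d} → st ≤ t → e ≤ len → e ≤ t ∸ st → o + e ≡ suc d → stripτ d ≤ t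
    before {t} {zero} {d} st≤t _ _ o+0≡1+d = subst (_≤ t) (sym τ≡st) st≤t
      where
      o≡1+d : o ≡ suc d
      o≡1+d = trans (sym (+-identityʳ o)) o+0≡1+d
      τ≡st : stripτ d ≡ st
      τ≡st = trans (cong (λ x → stripτ (x ∸ 1)) (sym o≡1+d)) (τ-before (subst (1 ≤_) (sym o≡1+d) (s≤s z≤n)))
    before {t} {suc e} {d} _ e<len e<t∸st o+e+1≡1+d =
      subst (λ x → stripτ x ≤ t) (suc-injective (trans (sym (+-suc o e)) o+e+1≡1+d))
        (swept (<⇒≤ e<len) (<⇒≤ e<t∸st))

    neighbours≤ : ∀ {t e w} → st ≤ t → e ≤ len → e ≤ t ∸ st →
                  Adjacent (i , o + e) w → w ≢ (i , suc (o + e)) → τ w ≤ t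
    neighbours≤ st≤t e≤len e≤t∸st = strip-neighbour≤ i<r₁ (swept e≤len e≤t∸st) (before st≤t e≤len e≤t∸st)

    waiting : ∀ t → t < st → Stage k m n τ path progress t
    waiting t t<st = stay-at (at-start (<⇒≤ t<st)) (at-start t<st)
      (trans (progress≡ z≤n (m≤n⇒m∸n≡0 t<st)) (sym (progress≡ z≤n (m≤n⇒m∸n≡0 (<⇒≤ t<st)))))
      (λ _ → twoUnprotectedNeighbours
        (i<m , ≤-<-trans (m∸n≤m o 1) (≤-<-trans (m≤m+n o len) end<n))
        (i<m , ≤-<-trans (+-monoʳ-≤ o 1≤len) end<n)
        (left refl (sym (m+[n∸m]≡n 1≤o)))
        (right refl (+-comm 1 o))
        (λ eq → <⇒≢ (≤-<-trans (m∸n≤m o 1) (m<m+n o (s≤s z≤n))) (cong proj₂ eq))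
        (subst (t <_) (sym (trans (τ-strip _ i<r₁) (τ-before 1≤o))) t<st)
        (subst (t <_) (sym (trans (τ-strip _ i<r₁) (τ-interior 1 ≤-refl 1≤len))) (≤-trans t<st (m≤m+n st 1))))
      where
      at-start : ∀ {t′} → t′ ≤ st → path t′ ≡ (i , o)
      at-start t′≤st = trans (path≡ z≤n (m≤n⇒m∸n≡0 t′≤st)) (cong (i ,_) (+-identityʳ o))
      1≤o = proj₁ (late⇒inner (≤-trans (s≤s z≤n) t<st))
      1≤len = proj₂ (late⇒inner (≤-trans (s≤s z≤n) t<st))

    moving : ∀ t → st ≤ t → t ∸ st < len → Stage k m n τ path progress t
    moving t st≤t e<len =
      advance-from (path≡ (<⇒≤ e<len) refl) (path≡ e<len (+-∸-assoc 1 st≤t))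
        (subst (_< k) (sym (progress≡ (<⇒≤ e<len) refl)) (<-≤-trans e<len len≤k))
        (trans (progress≡ e<len (+-∸-assoc 1 st≤t)) (cong suc (sym (progress≡ (<⇒≤ e<len) refl))))
        (right refl (sym (+-suc o e)))
        (subst (t <_) (sym (trans (τ-strip _ i<r₁) (τ-interior (suc e) (s≤s z≤n) e<len)))
          (≤-reflexive (sym (trans (+-suc st e) (cong suc (m+[n∸m]≡n st≤t))))))
        (λ w _ adj w≢next → neighbours≤ st≤t (<⇒≤ e<len) ≤-refl adj
          (λ eq → w≢next (trans eq (cong (i ,_) (sym (+-suc o e))))))
      where
      e = t ∸ st

    finished : ∀ t → st ≤ t → len ≤ t ∸ st → Stage k m n τ path progress t
    finished t st≤t len≤t∸st =
      stay-at (at-end len≤t∸st) (at-end (≤-trans len≤t∸st (∸-monoˡ-≤ st (n≤1+n t))))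
        (trans (m≤n⇒m⊓n≡m (≤-trans len≤t∸st (∸-monoˡ-≤ st (n≤1+n t)))) (sym (m≤n⇒m⊓n≡m len≤t∸st)))
        (λ mobile → noUnprotectedNeighbour (surrounded (subst (_< k) (m≤n⇒m⊓n≡m len≤t∸st) mobile)))
      where
      at-end : ∀ {t′} → len ≤ t′ ∸ st → path t′ ≡ (i , o + len)
      at-end len≤ = cong (λ p → i , o + p) (m≤n⇒m⊓n≡m len≤)
      surrounded : len < k → ∀ w → InGrid m n w → Adjacent (i , o + len) w → τ w ≤ t
      surrounded len<k (c , d) (_ , d<n) adj with (c , d) ≟C (i , suc (o + len))
      ... | yes refl = subst (_≤ t) (sym (trans (τ-strip _ i<r₁) τ-right)) z≤n
        where
        τ-right : stripτ (suc (o + len)) ≡ 0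
        τ-right = trans (cong stripτ (sym (+-suc o len))) (τ-after len<k (subst (_< n) (sym (+-suc o len)) d<n))
      ... | no  w≢right = neighbours≤ st≤t ≤-refl len≤t∸st adj w≢right

    stage : ∀ t → Stage k m n τ path progress t
    stage t with t <? st
    ... | yes t<st = waiting t t<st
    ... | no  t≮st with t ∸ st <? len
    ...   | yes e<len = moving t (≮⇒≥ t≮st) e<len
    ...   | no  e≮len = finished t (≮⇒≥ t≮st) (≮⇒≥ e≮len)

    visits : ∀ {e} → e ≤ len → path (stripτ (o + e)) ≡ (i , o + e)
    visits {zero}  _     = path≡ z≤n (trans (cong (λ j → stripτ j ∸ st) (+-identityʳ o))
                                      (trans (cong (_∸ st) τ-start) (0∸n≡0 st)))
    visits {suc e} e≤len = path≡ e≤len (trans (cong (_∸ st) (τ-interior (suc e) (s≤s z≤n) e≤len)) (m+n∸m≡n st (suc e)))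

    trajectory : Trajectory k m n τ
    trajectory = record
      { path        = path
      ; steps       = progress
      ; path-inGrid = λ t → i<m , ≤-<-trans (+-monoʳ-≤ o (m⊓n≤m len _)) end<n
      ; steps-0     = trans (cong (len ⊓_) (0∸n≡0 st)) (⊓-zeroʳ len)
      ; τ-path≤     = λ t → subst (_≤ t) (sym (τ-strip _ i<r₁)) (swept (m⊓n≤m len _) (m⊓n≤n len _))
      ; stage       = stage
      }

  initialSegment : 1 ≤ r₂ → Segment 0 0 (r₂ ∸ 1)
  initialSegment 1≤r₂ = record
    { len≤k      = ≤-trans (m∸n≤m r₂ 1) (≤-pred r₂<K)
    ; end<n      = <-≤-trans r₂∸1<r₂ (subst (r₂ ≤_) (sym n≡) (m≤m+n r₂ _))
    ; τ-start    = stripτ-initial 1≤r₂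
    ; τ-interior = λ e _ e≤r₂∸1 → stripτ-initial (<-≤-trans (s≤s e≤r₂∸1) (≤-reflexive (m+[n∸m]≡n 1≤r₂)))
    ; τ-before   = λ ()
    ; late⇒inner = λ ()
    ; τ-after    = λ _ _ → trans (cong stripτ r₂≡) (stripτ-segment 0 (s≤s z≤n))
    }
    where
    r₂∸1<r₂ : r₂ ∸ 1 < r₂
    r₂∸1<r₂ = ≤-reflexive (m+[n∸m]≡n 1≤r₂)
    r₂≡ : suc (r₂ ∸ 1) ≡ r₂ + 0 * K + 0
    r₂≡ = trans (m+[n∸m]≡n 1≤r₂) (sym (trans (+-identityʳ _) (+-identityʳ r₂)))

  segment : ∀ c → c < q₂ → Segment (r₂ + c * K) (departure c) k
  segment c c<q₂ = record
    { len≤k      = ≤-refl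
    ; end<n      = subst (_≤ n) (sym (segment-end c))
                     (subst (r₂ + suc c * K ≤_) (sym n≡) (+-monoʳ-≤ r₂ (*-monoˡ-≤ K c<q₂)))
    ; τ-start    = trans (cong stripτ (sym (+-identityʳ _))) (stripτ-segment c (s≤s z≤n))
    ; τ-interior = λ e 1≤e e≤k → trans (stripτ-segment c (s≤s e≤k)) (arrival-pos c 1≤e)
    ; τ-before   = before-τ c
    ; late⇒inner = λ 1≤dep → ≤-trans 1≤dep (departure≤ c) , 1≤k
    ; τ-after    = λ k<k → ⊥-elim (<-irrefl refl k<k)
    }
    where
    departure≤ : ∀ c → departure c ≤ r₂ + c * K
    departure≤ c = +-mono-≤ (m∸n≤m r₂ 1) (*-monoʳ-≤ c (n≤1+n k))
    before-τ : ∀ c → 1 ≤ r₂ + c * K → stripτ (r₂ + c * K ∸ 1) ≡ departure c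
    before-τ zero    1≤r₂+0 = begin
      stripτ (r₂ + 0 ∸ 1) ≡⟨ cong (λ x → stripτ (x ∸ 1)) (+-identityʳ r₂) ⟩
      stripτ (r₂ ∸ 1)     ≡⟨ stripτ-initial (≤-reflexive (m+[n∸m]≡n (subst (1 ≤_) (+-identityʳ r₂) 1≤r₂+0))) ⟩
      r₂ ∸ 1              ≡⟨ sym (+-identityʳ _) ⟩
      departure 0         ∎
      where open ≡-Reasoning
    before-τ (suc c) _      = begin
      stripτ (r₂ + suc c * K ∸ 1) ≡⟨ cong (λ x → stripτ (x ∸ 1)) (sym (segment-end c)) ⟩
      stripτ (r₂ + c * K + k)     ≡⟨ stripτ-segment c ≤-refl ⟩
      arrival c k                 ≡⟨ arrival-pos c 1≤k ⟩
      r₂ ∸ 1 + c * k + k          ≡⟨ +-assoc (r₂ ∸ 1) (c * k) k ⟩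
      r₂ ∸ 1 + (c * k + k)        ≡⟨ cong (r₂ ∸ 1 +_) (+-comm (c * k) k) ⟩
      departure (suc c)           ∎
      where open ≡-Reasoning

  module _ (b e j : ℕ) where
    columnτ≤readyτ : columnτ b e j ≤ readyτ b e j
    columnτ≤readyτ = ≤-trans (m≤m⊔n _ _) (≤-trans (m≤m⊔n _ _) (m≤m⊔n _ _))

    aboveτ≤readyτ : aboveτ b e j ≤ readyτ b e j
    aboveτ≤readyτ = ≤-trans (m≤n⊔m (columnτ b e j) _) (≤-trans (m≤m⊔n _ _) (m≤m⊔n _ _))

    leftτ≤readyτ : columnτ b e (j ∸ 1) ≤ readyτ b e j
    leftτ≤readyτ = ≤-trans (m≤n⊔m (columnτ b e j ⊔ aboveτ b e j) _) (m≤m⊔n _ _)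

    rightτ≤readyτ : columnτ b e (right-of j) ≤ readyτ b e j
    rightτ≤readyτ = m≤n⊔m _ _

  right-of-inner : ∀ {j} → suc j < n → right-of j ≡ suc j
  right-of-inner 1+j<n = m≤n⇒m⊓n≡m (∸-monoˡ-≤ 1 1+j<n)

  bandRow<m : ∀ {b e} → b < q₁ → e ≤ k → bandRow b e < m
  bandRow<m {b} {e} b<q₁ e≤k = subst (bandRow b e <_) (sym m≡) (+-monoʳ-< r₁ (begin-strict
    b * K + e ≤⟨ +-monoʳ-≤ (b * K) e≤k ⟩
    b * K + k <⟨ +-monoʳ-< (b * K) (n<1+n k) ⟩
    b * K + K ≡⟨ +-comm (b * K) K ⟩
    suc b * K ≤⟨ *-monoˡ-≤ K b<q₁ ⟩
    q₁ * K    ∎))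
    where open ≤-Reasoning

  above-exists : ∀ b e {j t} → t < aboveτ b e j → ∃ λ c → suc c ≡ bandRow b e
  above-exists b       (suc e) _ = bandRow b e , sym (bandRow-suc b e)
  above-exists (suc b) zero    _ = bandRow b k , sym (bandRow-next b)
  above-exists zero    zero {j} t<top with r₁ ≟ 0
  ... | yes _    = ⊥-elim (n≮0 t<top)
  ... | no  r₁≢0 = r₁ ∸ 1 , trans (m+[n∸m]≡n (n≢0⇒n>0 r₁≢0)) (sym (+-identityʳ r₁))

  module ColumnSearcher {b j} (b<q₁ : b < q₁) (j<n : j < n) where

    L : ℕ → ℕ
    L e = columnτ b e j

    open Walk k L refl (λ e _ → s≤s (columnτ≤readyτ b e j)) public

    path : ℕ → Cell
    path t = bandRow b (depth t) , j

    cell∈ : ∀ {e} → e ≤ k → InGrid m n (bandRow b e , j)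
    cell∈ e≤k = bandRow<m b<q₁ e≤k , j<n

    below≢ : ∀ {d j′} → (bandRow b d , j′) ≢ (bandRow b (suc d) , j)
    below≢ {d} eq = <⇒≢ (≤-reflexive (sym (bandRow-suc b d))) (cong (proj₁ {B = λ _ → ℕ}) eq)

    UnprotectedBesidesBelow : ℕ → ℕ → Set
    UnprotectedBesidesBelow d t =
      ∃ λ w → InGrid m n w × Adjacent (bandRow b d , j) w × w ≢ (bandRow b (suc d) , j) × t < τ w

    unprotected-above : ∀ {d t} → d ≤ k → t < aboveτ b d j → UnprotectedBesidesBelow d t
    unprotected-above {d} {t} d≤k t<above =
      let (c , 1+c≡row) = above-exists b d t<above
      in (c , j)
       , (<-trans (≤-reflexive 1+c≡row) (bandRow<m b<q₁ d≤k) , j<n)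
       , up (sym 1+c≡row) refl
       , (λ eq → <⇒≢ (<-trans (≤-reflexive 1+c≡row) (≤-reflexive (sym (bandRow-suc b d)))) (cong proj₁ eq))
       , subst (t <_) (sym (τ-above b d j (s≤s d≤k) 1+c≡row)) t<above

    unprotected-left : ∀ {d t} → d ≤ k → L d ≤ t → t < columnτ b d (j ∸ 1) → UnprotectedBesidesBelow d t
    unprotected-left {d} {t} d≤k arrived t<left with j ≟ 0
    ... | yes refl = ⊥-elim (<⇒≱ t<left arrived)
    ... | no  j≢0  = (bandRow b d , j ∸ 1)
       , (bandRow<m b<q₁ d≤k , ≤-<-trans (m∸n≤m j 1) j<n)
       , left refl (sym (m+[n∸m]≡n (n≢0⇒n>0 j≢0)))
       , below≢
       , subst (t <_) (sym (τ-band b (j ∸ 1) (s≤s d≤k))) t<left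

    unprotected-right : ∀ {d t} → d ≤ k → L d ≤ t → t < columnτ b d (right-of j) →
                        UnprotectedBesidesBelow d t
    unprotected-right {d} {t} d≤k arrived t<right with suc j <? n
    ... | yes 1+j<n =
      (bandRow b d , suc j) , (bandRow<m b<q₁ d≤k , 1+j<n) , right refl refl , below≢
      , subst (t <_) (sym (trans (τ-band b (suc j) (s≤s d≤k)) (cong (columnτ b d) (sym (right-of-inner 1+j<n)))))
          t<right
    ... | no 1+j≮n = ⊥-elim (<⇒≱ (subst (λ x → t < columnτ b d x) right-of≡j t<right) arrived)
      where
      right-of≡j : right-of j ≡ j
      right-of≡j = trans (cong (λ x → suc j ⊓ (x ∸ 1)) (≤-antisym (≮⇒≥ 1+j≮n) j<n)) (m≥n⇒m⊓n≡n (n≤1+n j))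

    unprotected-besides-below : ∀ {d t} → d ≤ k → L d ≤ t → t < readyτ b d j → UnprotectedBesidesBelow d t
    unprotected-besides-below {d} {t} d≤k arrived t<ready
      with t <? aboveτ b d j | t <? columnτ b d (j ∸ 1) | t <? columnτ b d (right-of j)
    ... | yes t<above | _          | _           = unprotected-above d≤k t<above
    ... | no  _       | yes t<left | _           = unprotected-left d≤k arrived t<left
    ... | no  _       | no  _      | yes t<right = unprotected-right d≤k arrived t<right
    ... | no  t≮above | no  t≮left | no  t≮right = ⊥-elim (<⇒≱ t<ready
          (⊔-lub (⊔-lub (⊔-lub arrived (≮⇒≥ t≮above)) (≮⇒≥ t≮left)) (≮⇒≥ t≮right)))

    descending : ∀ t → depth t < k → L (suc (depth t)) ≡ suc t → depth (suc t) ≡ suc (depth t) →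
                 Stage k m n τ path depth t
    descending t d<k arrival deeper =
      advance-from refl (cong (λ e → bandRow b e , j) deeper) d<k deeper
        (down (sym (bandRow-suc b d)) refl)
        (subst (t <_) (sym (trans (τ-band b j (s≤s d<k)) arrival)) ≤-refl)
        others
      where
      d = depth t
      d<K : d < K
      d<K = s≤s (<⇒≤ d<k)
      ready≤t : ∀ {x} → x ≤ readyτ b d j → x ≤ t
      ready≤t x≤ready = ≤-trans x≤ready (≤-reflexive (suc-injective arrival))
      others : OthersProtected m n τ (bandRow b d , j) (bandRow b (suc d) , j) t
      others (c , _) _ (up row≡1+c refl) _ =
        subst (_≤ t) (sym (τ-above b d j d<K (sym row≡1+c))) (ready≤t (aboveτ≤readyτ b d j))
      others (c , _) _ (down 1+row≡c refl) w≢below =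
        ⊥-elim (w≢below (cong (_, j) (trans (sym 1+row≡c) (sym (bandRow-suc b d)))))
      others (_ , j′) _ (left refl j≡1+j′) _ =
        subst (_≤ t) (sym (τ-band b j′ d<K))
          (subst (λ x → columnτ b d x ≤ t) (cong (_∸ 1) j≡1+j′) (ready≤t (leftτ≤readyτ b d j)))
      others (_ , j′) (_ , j′<n) (right refl refl) _ =
        subst (_≤ t) (sym (τ-band b (suc j) d<K))
          (subst (λ x → columnτ b d x ≤ t) (right-of-inner j′<n) (ready≤t (rightτ≤readyτ b d j)))

    waiting : ∀ t → depth t < k → suc t < L (suc (depth t)) → depth (suc t) ≡ depth t →
              Stage k m n τ path depth t
    waiting t d<k notDue same = stay (cong (λ e → bandRow b e , j) same) same λ _ →
      let d = depth t
          (w , w∈ , adj , w≢below , t<τw) =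
            unprotected-besides-below (<⇒≤ d<k) (arrived t) (≤-pred notDue)
      in twoUnprotectedNeighbours (cell∈ d<k) w∈ (down (sym (bandRow-suc b d)) refl) adj (w≢below ∘ sym)
           (subst (t <_) (sym (τ-band b j (s≤s d<k))) (<-trans (n<1+n t) notDue)) t<τw

    stage : ∀ t → Stage k m n τ path depth t
    stage t with depth-step t
    ... | descend d<k due deeper = descending t d<k (≤-antisym due (pending t d<k)) deeper
    ... | wait d<k notDue same   = waiting t d<k notDue same
    ... | bottom d≮k same        = stay (cong (λ e → bandRow b e , j) same) same (⊥-elim ∘ d≮k)

    visits : ∀ {e} → e ≤ k → path (L e) ≡ (bandRow b e , j)
    visits {e} e≤k = cong (λ d → bandRow b d , j) (depth-L e e≤k)

    trajectory : Trajectory k m n τ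
    trajectory = record
      { path        = path
      ; steps       = depth
      ; path-inGrid = λ t → cell∈ (depth≤k t)
      ; steps-0     = refl
      ; τ-path≤     = λ t → subst (_≤ t) (sym (τ-band b j (s≤s (depth≤k t)))) (arrived t)
      ; stage       = stage
      }

  Searcher : Set
  Searcher = (Fin q₁ × Fin n) ⊎ (Fin r₁ × Fin (suc q₂))

  enumeration : Fin (q₁ * n + r₁ * suc q₂) ↔ Searcher
  enumeration = (*↔× ⊎-↔ *↔×) ↔-∘ +↔⊎

  1≤r₂ : ∀ {i} → i < r₁ → 1 ≤ r₂
  1≤r₂ i<r₁ = ≤-trans (≤-trans (s≤s z≤n) i<r₁) r₁≤r₂

  trajectory : Searcher → Trajectory k m n τ
  trajectory (inj₁ (b , j))       = ColumnSearcher.trajectory (toℕ<n b) (toℕ<n j)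
  trajectory (inj₂ (i , F.zero))  = SegmentSearcher.trajectory (toℕ<n i) (initialSegment (1≤r₂ (toℕ<n i)))
  trajectory (inj₂ (i , F.suc c)) = SegmentSearcher.trajectory (toℕ<n i) (segment (toℕ c) (toℕ<n c))

  path : Searcher → ℕ → Cell
  path σ = Trajectory.path (trajectory σ)

  Visited : Cell → Set
  Visited u = ∃ λ σ → path σ (τ u) ≡ u

  visited-initial : ∀ {i j} → i < r₁ → j < r₂ → Visited (i , j)
  visited-initial {i} {j} i<r₁ j<r₂ = σ , subst (λ u → path σ (τ u) ≡ u) (cong (_, j) (toℕ-fromℕ< i<r₁)) visit
    where
    i′ = fromℕ< i<r₁
    σ = inj₂ (i′ , F.zero)
    visit : path σ (τ (toℕ i′ , j)) ≡ (toℕ i′ , j)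
    visit = trans (cong (path σ) (τ-strip j (toℕ<n i′)))
      (SegmentSearcher.visits (toℕ<n i′) (initialSegment (1≤r₂ (toℕ<n i′)))
        (≤-pred (<-≤-trans j<r₂ (≤-reflexive (sym (m+[n∸m]≡n (1≤r₂ (toℕ<n i′))))))))

  visited-segment : ∀ {i j} → i < r₁ → r₂ ≤ j → j < n → Visited (i , j)
  visited-segment {i} {j} i<r₁ r₂≤j j<n = σ , subst (λ u → path σ (τ u) ≡ u) cell≡ visit
    where
    x = j ∸ r₂
    c<q₂ : x / K < q₂
    c<q₂ = m<n*o⇒m/o<n (subst (x <_) (m+n∸m≡n r₂ (q₂ * K)) (∸-monoˡ-< (subst (j <_) n≡ j<n) r₂≤j))
    i′ = fromℕ< i<r₁
    c′ = fromℕ< c<q₂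
    σ = inj₂ (i′ , F.suc c′)
    visit : path σ (τ (toℕ i′ , r₂ + toℕ c′ * K + x % K)) ≡ (toℕ i′ , r₂ + toℕ c′ * K + x % K)
    visit = trans (cong (path σ) (τ-strip _ (toℕ<n i′)))
      (SegmentSearcher.visits (toℕ<n i′) (segment (toℕ c′) (toℕ<n c′)) (≤-pred (m%n<n x K)))
    cell≡ : (toℕ i′ , r₂ + toℕ c′ * K + x % K) ≡ (i , j)
    cell≡ = cong₂ _,_ (toℕ-fromℕ< i<r₁) (begin
      r₂ + toℕ c′ * K + x % K       ≡⟨ cong (λ y → r₂ + y * K + x % K) (toℕ-fromℕ< c<q₂) ⟩
      r₂ + x / K * K + x % K        ≡⟨ +-assoc r₂ _ _ ⟩
      r₂ + (x / K * K + x % K)      ≡⟨ cong (r₂ +_) (sym (m≡[m/n]*n+m%n K x)) ⟩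
      r₂ + x                        ≡⟨ m+[n∸m]≡n r₂≤j ⟩
      j                             ∎)
      where open ≡-Reasoning

  visited-band : ∀ {i j} → r₁ ≤ i → i < m → j < n → Visited (i , j)
  visited-band {i} {j} r₁≤i i<m j<n = σ , subst (λ u → path σ (τ u) ≡ u) cell≡ visit
    where
    d = i ∸ r₁
    b<q₁ : d / K < q₁
    b<q₁ = m<n*o⇒m/o<n (subst (d <_) (m+n∸m≡n r₁ (q₁ * K)) (∸-monoˡ-< (subst (i <_) m≡ i<m) r₁≤i))
    e≤k : d % K ≤ k
    e≤k = ≤-pred (m%n<n d K)
    b′ = fromℕ< b<q₁
    j′ = fromℕ< j<n
    σ = inj₁ (b′ , j′)
    visit : path σ (τ (bandRow (toℕ b′) (d % K) , toℕ j′)) ≡ (bandRow (toℕ b′) (d % K) , toℕ j′)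
    visit = trans (cong (path σ) (τ-band (toℕ b′) (toℕ j′) (s≤s e≤k)))
                  (ColumnSearcher.visits (toℕ<n b′) (toℕ<n j′) e≤k)
    cell≡ : (bandRow (toℕ b′) (d % K) , toℕ j′) ≡ (i , j)
    cell≡ = cong₂ _,_ (begin
      r₁ + (toℕ b′ * K + d % K)  ≡⟨ cong (λ y → r₁ + (y * K + d % K)) (toℕ-fromℕ< b<q₁) ⟩
      r₁ + (d / K * K + d % K)   ≡⟨ cong (r₁ +_) (sym (m≡[m/n]*n+m%n K d)) ⟩
      r₁ + d                     ≡⟨ m+[n∸m]≡n r₁≤i ⟩
      i                          ∎) (toℕ-fromℕ< j<n)
      where open ≡-Reasoning

  visited : ∀ u → InGrid m n u → Visited u
  visited (i , j) (i<m , j<n) = by-region (i <? r₁) (j <? r₂)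
    where
    by-region : Dec (i < r₁) → Dec (j < r₂) → Visited (i , j)
    by-region (yes i<r₁) (yes j<r₂) = visited-initial i<r₁ j<r₂
    by-region (yes i<r₁) (no  j≮r₂) = visited-segment i<r₁ (≮⇒≥ j≮r₂) j<n
    by-region (no  i≮r₁) _          = visited-band (≮⇒≥ i≮r₁) i<m j<n

  strip-row : ∀ i c t → proj₁ (path (inj₂ (i , c)) t) ≡ toℕ i
  strip-row i F.zero    t = refl
  strip-row i (F.suc c) t = refl

  strip≢band : ∀ {i} → i < r₁ → ∀ b e → i ≢ bandRow b e
  strip≢band i<r₁ b e eq = <⇒≱ i<r₁ (subst (r₁ ≤_) (sym eq) (m≤m+n r₁ _))

  segment-injective : ∀ (i i′ : Fin r₁) c c′ t →
                      proj₂ (path (inj₂ (i , c)) t) ≡ proj₂ (path (inj₂ (i′ , c′)) t) → c ≡ c′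
  segment-injective i i′ F.zero    F.zero     t _  = refl
  segment-injective i i′ F.zero    (F.suc c′) t eq =
    ⊥-elim (<⇒≱ (initial<r₂ i t) (subst (r₂ ≤_) (sym eq) (≤-trans (m≤m+n r₂ _) (m≤m+n _ _))))
    where
    initial<r₂ : ∀ (i : Fin r₁) t → (r₂ ∸ 1) ⊓ t < r₂
    initial<r₂ i t = ≤-<-trans (m⊓n≤m (r₂ ∸ 1) t) (≤-reflexive (m+[n∸m]≡n (1≤r₂ (toℕ<n i))))
  segment-injective i i′ (F.suc c) F.zero      t eq = sym (segment-injective i′ i F.zero (F.suc c) t (sym eq))
  segment-injective i i′ (F.suc c) (F.suc c′)  t eq = cong F.suc (toℕ-injective
    ([m*n+o]≡[p*n+q]⇒m≡p K (s≤s (m⊓n≤m k _)) (s≤s (m⊓n≤m k _))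
      (+-cancelˡ-≡ r₂ _ _ (trans (sym (+-assoc r₂ _ _)) (trans eq (+-assoc r₂ _ _))))))

  path-injective : ∀ σ σ′ t → path σ t ≡ path σ′ t → σ ≡ σ′
  path-injective (inj₁ (b , j)) (inj₁ (b′ , j′)) t eq = cong inj₁ (cong₂ _,_
    (toℕ-injective ([m*n+o]≡[p*n+q]⇒m≡p K
      (s≤s (ColumnSearcher.depth≤k (toℕ<n b) (toℕ<n j) t)) (s≤s (ColumnSearcher.depth≤k (toℕ<n b′) (toℕ<n j′) t))
      (+-cancelˡ-≡ r₁ _ _ (cong proj₁ eq))))
    (toℕ-injective (cong proj₂ eq)))
  path-injective (inj₁ (b , j)) (inj₂ (i , c)) t eq =
    ⊥-elim (strip≢band (toℕ<n i) (toℕ b) _ (trans (sym (strip-row i c t)) (sym (cong proj₁ eq))))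
  path-injective (inj₂ (i , c)) (inj₁ (b , j)) t eq =
    ⊥-elim (strip≢band (toℕ<n i) (toℕ b) _ (trans (sym (strip-row i c t)) (cong proj₁ eq)))
  path-injective (inj₂ (i , c)) (inj₂ (i′ , c′)) t eq = cong₂ (λ x y → inj₂ (x , y))
    (toℕ-injective (trans (sym (strip-row i c t)) (trans (cong proj₁ eq) (strip-row i′ c′ t))))
    (segment-injective i i′ c c′ t (cong proj₂ eq))

  schedule : Schedule k m n
  schedule = record
    { Searcher       = Searcher
    ; count          = q₁ * n + r₁ * suc q₂
    ; enumeration    = enumeration
    ; τ              = τ
    ; end            = n + m
    ; τ≤end          = τ≤n+m
    ; trajectory     = trajectory
    ; visited-at-τ   = visited
    ; path-injective = path-injective
    }

  count≡ : q₁ * n + r₁ * suc q₂ ≡ (m * n ∸ r₁ * r₂) / K + r₁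
  count≡ = begin
    q₁ * n + r₁ * suc q₂
      ≡⟨ cong (λ x → q₁ * x + r₁ * suc q₂) n≡ ⟩
    q₁ * (r₂ + q₂ * K) + r₁ * suc q₂
      ≡⟨ searcher-count K q₁ r₁ q₂ r₂ ⟩
    ((r₁ + q₁ * K) * (r₂ + q₂ * K) ∸ r₁ * r₂) / K + r₁
      ≡⟨ cong (λ x → (x ∸ r₁ * r₂) / K + r₁) (sym (cong₂ _*_ m≡ n≡)) ⟩
    (m * n ∸ r₁ * r₂) / K + r₁
      ∎
    where open ≡-Reasoning

theorem4p9 : (k m n : ℕ) → 1 ≤ k → 2 ≤ m → 2 ≤ n →
    dk≤ k m n (((m * n) ∸ ((m % suc k) * (n % suc k))) / suc k
    + ((m % suc k) ⊓ (n % suc k)))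
theorem4p9 k m n 1≤k _ _ = by-order (r₁ ≤? r₂)
  -- the construction also works for m < 2 or n < 2
  where
  open ≡-Reasoning
  r₁ = m % suc k
  r₂ = n % suc k
  quotient = (m * n ∸ r₁ * r₂) / suc k
  by-order : Dec (r₁ ≤ r₂) → dk≤ k m n (quotient + r₁ ⊓ r₂)
  by-order (yes r₁≤r₂) =
    schedule⇒dk≤ (Construction.schedule k m n 1≤k r₁≤r₂) (≤-reflexive (begin
    _                  ≡⟨ Construction.count≡ k m n 1≤k r₁≤r₂ ⟩
    quotient + r₁      ≡⟨ cong (quotient +_) (sym (m≤n⇒m⊓n≡m r₁≤r₂)) ⟩
    quotient + r₁ ⊓ r₂ ∎))
  by-order (no r₁≰r₂) =
    schedule⇒dk≤ (transpose (Construction.schedule k n m 1≤k r₂≤r₁)) (≤-reflexive (begin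
    _                                  ≡⟨ Construction.count≡ k n m 1≤k r₂≤r₁ ⟩
    (n * m ∸ r₂ * r₁) / suc k + r₂     ≡⟨ cong₂ (λ x y → (x ∸ y) / suc k + r₂) (*-comm n m) (*-comm r₂ r₁) ⟩
    quotient + r₂                      ≡⟨ cong (quotient +_) (sym (m≥n⇒m⊓n≡n r₂≤r₁)) ⟩
    quotient + r₁ ⊓ r₂                 ∎))
    where r₂≤r₁ = <⇒≤ (≰⇒> r₁≰r₂)
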